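{- Let $p$ be a prime with $p\equiv 1 \pmod 3$ and let $\mathcal{R}=\mathbb{F}_p+u\mathbb{F}_p+u^2\mathbb{F}_p+u^3\mathbb{F}_p$ with $u^4=u$. Let $\Phi:\mathcal{R}^n\to\mathbb{F}_p^{2n}$ be the Gray map $$(r_0,\dots,r_{n-1})\mapsto(-d_0,\dots,-d_{n-1},\,2a_0+d_0,\dots,2a_{n-1}+d_{n-1}),\qquad r_i=a_i+b_iu+c_iu^2+d_iu^3 .$$ Let $\mathcal{C}$ be a linear code of length $n$ over $\mathcal{R}$ with $\mathcal{C}\subseteq(\mathbb{F}_p+u^3\mathbb{F}_p)^n$. If $\mathcal{C}$ is self-orthogonal, then $\Phi(\mathcal{C})$ is self-orthogonal.
   Context: $\mathcal{R}=\mathbb{F}_p[u]/\langle u^4-u\rangle$, a commutative ring of order $p^4$. A linear code of length $n$ over $\mathcal{R}$ is an $\mathcal{R}$-submodule of $\mathcal{R}^n$. Duality is with respect to the Euclidean inner product $x\cdot y=\sum_i x_iy_i$ (over $\mathcal{R}$, resp. over $\mathbb{F}_p$ for $\Phi(\mathcal{C})$); a code $D$ is self-orthogonal if $D\subseteq D^\perp$. -}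

module Defs where

open import Data.Nat as ℕ using (ℕ; zero; suc; NonZero)
open import Data.Nat.DivMod using (_mod_)
open import Data.Fin as Fin using (Fin; toℕ)
open import Data.Product using (Σ; ∃; _×_; _,_)
open import Data.Vec.Functional using (Vector; _++_)
open import Relation.Binary.PropositionalEquality using (_≡_)

module Field (p : ℕ) .{{_ : NonZero p}} where

  Fp : Set
  Fp = Fin p

  0F : Fp
  0F = 0 mod p

  _+F_ : Fp → Fp → Fp
  a +F b = (toℕ a ℕ.+ toℕ b) mod p

  _*F_ : Fp → Fp → Fp
  a *F b = (toℕ a ℕ.* toℕ b) mod p

  -F_ : Fp → Fp
  -F a = (p ℕ.∸ toℕ a) mod p

  2F : Fp
  2F = 2 mod p

  infixl 6 _+F_
  infixl 7 _*F_

  -- The ring R = F_p + u F_p + u^2 F_p + u^3 F_p with u^4 = u;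
  -- an element a + b u + c u^2 + d u^3.
  record R : Set where
    constructor ⟨_,_,_,_⟩
    field
      a b c d : Fp
  open R public

  0R : R
  0R = ⟨ 0F , 0F , 0F , 0F ⟩

  _+R_ : R → R → R
  x +R y = ⟨ a x +F a y , b x +F b y , c x +F c y , d x +F d y ⟩

  -- multiplication using u^4 = u, u^5 = u^2, u^6 = u^3
  _*R_ : R → R → R
  x *R y = ⟨ a x *F a y
           , a x *F b y +F b x *F a y
               +F (b x *F d y +F c x *F c y +F d x *F b y)
           , a x *F c y +F b x *F b y +F c x *F a y
               +F (c x *F d y +F d x *F c y)
           , a x *F d y +F b x *F c y +F c x *F b y +F d x *F a y
               +F d x *F d y ⟩

  infixl 6 _+R_
  infixl 7 _*R_

  sumF : ∀ {n} → Vector Fp n → Fp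
  sumF {zero} v = 0F
  sumF {suc n} v = v Fin.zero +F sumF (λ i → v (Fin.suc i))

  sumR : ∀ {n} → Vector R n → R
  sumR {zero} v = 0R
  sumR {suc n} v = v Fin.zero +R sumR (λ i → v (Fin.suc i))

  _·R_ : ∀ {n} → Vector R n → Vector R n → R
  x ·R y = sumR (λ i → x i *R y i)

  _·F_ : ∀ {n} → Vector Fp n → Vector Fp n → Fp
  x ·F y = sumF (λ i → x i *F y i)

  record IsLinearCode {n : ℕ} (C : Vector R n → Set) : Set where
    field
      zero-mem : C (λ _ → 0R)
      add-mem  : ∀ x y → C x → C y → C (λ i → x i +R y i)
      smul-mem : ∀ (r : R) x → C x → C (λ i → r *R x i)

  SelfOrthogonalR : ∀ {n} → (Vector R n → Set) → Set
  SelfOrthogonalR C = ∀ x y → C x → C y → x ·R y ≡ 0R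

  SelfOrthogonalF : ∀ {m} → (Vector Fp m → Set) → Set
  SelfOrthogonalF D = ∀ x y → D x → D y → x ·F y ≡ 0F

  Φ : ∀ {n} → Vector R n → Vector Fp (n ℕ.+ n)
  Φ r = (λ i → -F d (r i)) ++ (λ i → 2F *F a (r i) +F d (r i))

  ΦImage : ∀ {n} → (Vector R n → Set) → Vector Fp (n ℕ.+ n) → Set
  ΦImage C y = Σ _ λ x → C x × Φ x ≡ y

  InFpPlusU3 : ∀ {n} → (Vector R n → Set) → Set
  InFpPlusU3 C = ∀ x → C x → ∀ i → b (x i) ≡ 0F × c (x i) ≡ 0F

-- Write r = a + b u + c u² + d u³ and consider r, s ∈ R with b r = c r = 0.
-- Expanding with u⁴ = u gives
--     a (r s) = a_r a_s ,   d (r s) = a_r d_s + d_r a_s + d_r d_s ,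
-- while the two Gray coordinates of a position contribute
--     (-d_r)(-d_s) + (2a_r + d_r)(2a_s + d_s)
--       = 4 a_r a_s + 2 (a_r d_s + d_r a_s + d_r d_s).
-- Summing over positions, Φ x · Φ y = 4 a (x · y) + 2 d (x · y), which is
-- 0 whenever x · y = 0 in R.

module Submission where

open import Defs
open import Data.Nat using (ℕ; NonZero; _%_; zero; suc; _+_; _*_; _∸_; >-nonZero⁻¹)
open import Data.Nat.Primality using (Prime)
open import Data.Vec.Functional using (Vector)
open import Relation.Binary.PropositionalEquality
  using (_≡_; refl; sym; trans; cong; cong₂)
open import Data.Nat.Properties
  using (+-*-semiring; +-assoc; *-zeroʳ; +-identityʳ; m∸n+n≡m; <⇒≤)
open import Data.Nat.DivMod
  using (_mod_; %-distribˡ-+; %-distribˡ-*; m%n%n≡m%n; m%n<n; n%n≡0; m<n⇒m%n≡m)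
open import Data.Nat.Tactic.RingSolver using (solve-∀)
open import Data.Fin as Fin using (toℕ; _↑ˡ_; _↑ʳ_)
open import Data.Fin.Properties using (toℕ-injective; toℕ<n; toℕ-fromℕ<)
open import Data.Vec.Functional.Properties using (lookup-++ˡ; lookup-++ʳ)
open import Data.Product using (_,_; _×_; proj₁; proj₂)
open import Function using (_∘_)
open import Level using (0ℓ)
open import Relation.Binary.Bundles using (Setoid)
import Relation.Binary.Reasoning.Setoid as SetoidReasoning

open import Algebra.Properties.Semiring.Sum +-*-semiring
  using (sum; ∑-distrib-+; *-distribˡ-sum; sum-cong-≗)

sum-split : ∀ m n (h : Vector ℕ (m + n)) →
            sum h ≡ sum (λ i → h (i ↑ˡ n)) + sum (λ i → h (m ↑ʳ i))
sum-split zero    n h = refl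
sum-split (suc m) n h =
  trans (cong (h Fin.zero +_) (sum-split m n (h ∘ Fin.suc)))
        (sym (+-assoc (h Fin.zero) _ _))

sum-linear : ∀ {n} k l (f g : Vector ℕ n) →
             sum (λ i → k * f i + l * g i) ≡ k * sum f + l * sum g
sum-linear k l f g =
  trans (∑-distrib-+ (λ i → k * f i) (λ i → l * g i))
        (sym (cong₂ _+_ (*-distribˡ-sum k f) (*-distribˡ-sum l g)))

module ModularArithmetic (p : ℕ) .{{_ : NonZero p}} where
  open Field p

  infix 4 _≋_
  _≋_ : ℕ → ℕ → Set
  m ≋ n = m % p ≡ n % p

  ≋-setoid : Setoid 0ℓ 0ℓ
  ≋-setoid = record
    { Carrier = ℕ ; _≈_ = _≋_
    ; isEquivalence = record { refl = refl ; sym = sym ; trans = trans } }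

  open SetoidReasoning ≋-setoid public

  ≋-refl : ∀ {m} → m ≋ m
  ≋-refl = refl

  +-cong : ∀ {m m′ n n′} → m ≋ m′ → n ≋ n′ → m + n ≋ m′ + n′
  +-cong {m} {m′} {n} {n′} m≋m′ n≋n′ =
    trans (%-distribˡ-+ m n p)
      (trans (cong₂ (λ x y → (x + y) % p) m≋m′ n≋n′) (sym (%-distribˡ-+ m′ n′ p)))

  *-cong : ∀ {m m′ n n′} → m ≋ m′ → n ≋ n′ → m * n ≋ m′ * n′
  *-cong {m} {m′} {n} {n′} m≋m′ n≋n′ =
    trans (%-distribˡ-* m n p)
      (trans (cong₂ (λ x y → (x * y) % p) m≋m′ n≋n′) (sym (%-distribˡ-* m′ n′ p)))

  sum-cong : ∀ {n} {f g : Vector ℕ n} → (∀ i → f i ≋ g i) → sum f ≋ sum g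
  sum-cong {zero}  f≋g = refl
  sum-cong {suc n} f≋g = +-cong (f≋g Fin.zero) (sum-cong (f≋g ∘ Fin.suc))

  ⟦_⟧ : Fp → ℕ
  ⟦ x ⟧ = toℕ x

  ⟦⟧-injective : ∀ {x y : Fp} → ⟦ x ⟧ ≋ ⟦ y ⟧ → x ≡ y
  ⟦⟧-injective {x} {y} x≋y = toℕ-injective
    (trans (sym (m<n⇒m%n≡m (toℕ<n x))) (trans x≋y (m<n⇒m%n≡m (toℕ<n y))))

  ⟦mod⟧ : ∀ m → ⟦ m mod p ⟧ ≋ m
  ⟦mod⟧ m = trans (cong (_% p) (toℕ-fromℕ< (m%n<n m p))) (m%n%n≡m%n m p)

  -- Reflexivity at a named element, which fixes the element for inference.
  ⟦_⟧-refl : ∀ x → ⟦ x ⟧ ≋ ⟦ x ⟧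
  ⟦ x ⟧-refl = refl

  ⟦0F⟧ : ⟦ 0F ⟧ ≋ 0
  ⟦0F⟧ = ⟦mod⟧ 0

  ⟦2F⟧ : ⟦ 2F ⟧ ≋ 2
  ⟦2F⟧ = ⟦mod⟧ 2

  -- The lift is a homomorphism modulo p; stated for arbitrary lifts of the
  -- arguments so that lifts of whole expressions compose.
  ⟦+F⟧ : ∀ {x y m n} → ⟦ x ⟧ ≋ m → ⟦ y ⟧ ≋ n → ⟦ x +F y ⟧ ≋ m + n
  ⟦+F⟧ x≋m y≋n = trans (⟦mod⟧ _) (+-cong x≋m y≋n)

  ⟦*F⟧ : ∀ {x y m n} → ⟦ x ⟧ ≋ m → ⟦ y ⟧ ≋ n → ⟦ x *F y ⟧ ≋ m * n
  ⟦*F⟧ x≋m y≋n = trans (⟦mod⟧ _) (*-cong x≋m y≋n)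

  ⟦0⟧ : ∀ {x} → x ≡ 0F → ⟦ x ⟧ ≋ 0
  ⟦0⟧ refl = ⟦0F⟧

  p≋0 : p ≋ 0
  p≋0 = trans (n%n≡0 p) (sym (m<n⇒m%n≡m {n = p} (>-nonZero⁻¹ p)))

  ⟦-F⟧-inverse : ∀ x → ⟦ -F x ⟧ + ⟦ x ⟧ ≋ 0
  ⟦-F⟧-inverse x = begin
    ⟦ -F x ⟧ + ⟦ x ⟧      ≈⟨ +-cong (⟦mod⟧ (p ∸ ⟦ x ⟧)) ≋-refl ⟩
    p ∸ ⟦ x ⟧ + ⟦ x ⟧     ≡⟨ m∸n+n≡m (<⇒≤ (toℕ<n x)) ⟩
    p                     ≈⟨ p≋0 ⟩
    0                     ∎

  ⟦-F⟧-product : ∀ x y → ⟦ -F x ⟧ * ⟦ -F y ⟧ ≋ ⟦ x ⟧ * ⟦ y ⟧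
  ⟦-F⟧-product x y = begin
    e * e′                   ≡⟨ sym (+-identityʳ (e * e′)) ⟩
    e * e′ + 0 * Y           ≈⟨ +-cong {e * e′} ≋-refl (*-cong {n = Y} (sym (⟦-F⟧-inverse x)) ≋-refl) ⟩
    e * e′ + (e + X) * Y     ≡⟨ regroup e e′ X Y ⟩
    e * (e′ + Y) + X * Y     ≈⟨ +-cong {n = X * Y} (*-cong {e} ≋-refl (⟦-F⟧-inverse y)) ≋-refl ⟩
    e * 0 + X * Y            ≡⟨ cong (_+ X * Y) (*-zeroʳ e) ⟩
    X * Y                    ∎
    where
    e = ⟦ -F x ⟧
    e′ = ⟦ -F y ⟧
    X = ⟦ x ⟧
    Y = ⟦ y ⟧
    regroup : ∀ e e′ X Y → e * e′ + (e + X) * Y ≡ e * (e′ + Y) + X * Y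
    regroup = solve-∀

  ⟦sumF⟧ : ∀ {n} (v : Vector Fp n) → ⟦ sumF v ⟧ ≋ sum (⟦_⟧ ∘ v)
  ⟦sumF⟧ {zero}  v = ⟦0F⟧
  ⟦sumF⟧ {suc n} v = ⟦+F⟧ ⟦ v Fin.zero ⟧-refl (⟦sumF⟧ (v ∘ Fin.suc))

  coordinate-sumR : (π : R → Fp) → (∀ r s → π (r +R s) ≡ π r +F π s) →
                    π 0R ≡ 0F → ∀ {n} (v : Vector R n) → π (sumR v) ≡ sumF (π ∘ v)
  coordinate-sumR π π-+ π-0 {zero}  v = π-0
  coordinate-sumR π π-+ π-0 {suc n} v =
    trans (π-+ (v Fin.zero) (sumR (v ∘ Fin.suc)))
          (cong (π (v Fin.zero) +F_) (coordinate-sumR π π-+ π-0 (v ∘ Fin.suc)))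

  ⟦a-product⟧ : ∀ r s → ⟦ a (r *R s) ⟧ ≋ ⟦ a r ⟧ * ⟦ a s ⟧
  ⟦a-product⟧ r s = ⟦*F⟧ ⟦ a r ⟧-refl ⟦ a s ⟧-refl

  ⟦d-product⟧ : ∀ r s → b r ≡ 0F → c r ≡ 0F →
                ⟦ d (r *R s) ⟧ ≋ ⟦ a r ⟧ * ⟦ d s ⟧ + ⟦ d r ⟧ * ⟦ a s ⟧ + ⟦ d r ⟧ * ⟦ d s ⟧
  ⟦d-product⟧ r s br≡0 cr≡0 = begin
    ⟦ d (r *R s) ⟧
      ≈⟨ ⟦+F⟧ (⟦+F⟧ (⟦+F⟧ (⟦+F⟧ (⟦*F⟧ ⟦ a r ⟧-refl ⟦ d s ⟧-refl)
                                (⟦*F⟧ (⟦0⟧ br≡0) ⟦ c s ⟧-refl))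
                          (⟦*F⟧ (⟦0⟧ cr≡0) ⟦ b s ⟧-refl))
                   (⟦*F⟧ ⟦ d r ⟧-refl ⟦ a s ⟧-refl))
              (⟦*F⟧ ⟦ d r ⟧-refl ⟦ d s ⟧-refl) ⟩
    ar * ds + 0 * ⟦ c s ⟧ + 0 * ⟦ b s ⟧ + dr * as + dr * ds
      ≡⟨ drop-zeros ar ds (⟦ c s ⟧) (⟦ b s ⟧) dr as ⟩
    ar * ds + dr * as + dr * ds
      ∎
    where
    ar = ⟦ a r ⟧
    as = ⟦ a s ⟧
    dr = ⟦ d r ⟧
    ds = ⟦ d s ⟧
    drop-zeros : ∀ ar ds cs bs dr as →
                 ar * ds + 0 * cs + 0 * bs + dr * as + dr * ds ≡ ar * ds + dr * as + dr * ds
    drop-zeros = solve-∀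

  Φ-left : ∀ {n} (r : Vector R n) i → Φ r (i ↑ˡ n) ≡ -F d (r i)
  Φ-left r i = lookup-++ˡ _ _ i

  Φ-right : ∀ {n} (r : Vector R n) i → Φ r (n ↑ʳ i) ≡ 2F *F a (r i) +F d (r i)
  Φ-right {n} r i = lookup-++ʳ {m = n} _ _ i

  ⟦2a+d⟧ : ∀ r → ⟦ 2F *F a r +F d r ⟧ ≋ 2 * ⟦ a r ⟧ + ⟦ d r ⟧
  ⟦2a+d⟧ r = ⟦+F⟧ (⟦*F⟧ ⟦2F⟧ ⟦ a r ⟧-refl) ⟦ d r ⟧-refl

  ⟦coordinate-inner⟧ : (π : R → Fp) → (∀ r s → π (r +R s) ≡ π r +F π s) →
                       π 0R ≡ 0F → ∀ {n} (x y : Vector R n) →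
                       ⟦ π (x ·R y) ⟧ ≋ sum (λ i → ⟦ π (x i *R y i) ⟧)
  ⟦coordinate-inner⟧ π π-+ π-0 x y = begin
    ⟦ π (x ·R y) ⟧                        ≡⟨ cong ⟦_⟧ (coordinate-sumR π π-+ π-0 (λ i → x i *R y i)) ⟩
    ⟦ sumF (λ i → π (x i *R y i)) ⟧       ≈⟨ ⟦sumF⟧ (λ i → π (x i *R y i)) ⟩
    sum (λ i → ⟦ π (x i *R y i) ⟧)        ∎

  module _ {n} (x y : Vector R n) where
    A D A′ D′ : Vector ℕ n
    A  i = ⟦ a (x i) ⟧
    D  i = ⟦ d (x i) ⟧
    A′ i = ⟦ a (y i) ⟧
    D′ i = ⟦ d (y i) ⟧

    a-inner d-inner : ℕ
    a-inner = sum (λ i → A i * A′ i)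
    d-inner = sum (λ i → A i * D′ i + D i * A′ i + D i * D′ i)

    ⟦a-inner⟧ : ⟦ a (x ·R y) ⟧ ≋ a-inner
    ⟦a-inner⟧ = trans (⟦coordinate-inner⟧ a (λ _ _ → refl) refl x y)
                      (sum-cong (λ i → ⟦a-product⟧ (x i) (y i)))

    ⟦d-inner⟧ : (∀ i → b (x i) ≡ 0F × c (x i) ≡ 0F) → ⟦ d (x ·R y) ⟧ ≋ d-inner
    ⟦d-inner⟧ x∈Fp+u³Fp = trans (⟦coordinate-inner⟧ d (λ _ _ → refl) refl x y)
      (sum-cong (λ i → ⟦d-product⟧ (x i) (y i) (proj₁ (x∈Fp+u³Fp i)) (proj₂ (x∈Fp+u³Fp i))))

    ⟦gray-inner⟧ : ⟦ Φ x ·F Φ y ⟧ ≋ 4 * a-inner + 2 * d-inner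
    ⟦gray-inner⟧ = begin
      ⟦ Φ x ·F Φ y ⟧
        ≈⟨ ⟦sumF⟧ (λ j → Φ x j *F Φ y j) ⟩
      sum (λ j → ⟦ Φ x j *F Φ y j ⟧)
        ≡⟨ sum-split n n (λ j → ⟦ Φ x j *F Φ y j ⟧) ⟩
      sum (λ i → ⟦ Φ x (i ↑ˡ n) *F Φ y (i ↑ˡ n) ⟧) + sum (λ i → ⟦ Φ x (n ↑ʳ i) *F Φ y (n ↑ʳ i) ⟧)
        ≈⟨ +-cong (sum-cong left) (sum-cong right) ⟩
      sum (λ i → D i * D′ i) + sum (λ i → (2 * A i + D i) * (2 * A′ i + D′ i))
        ≡⟨ sym (∑-distrib-+ (λ i → D i * D′ i) (λ i → (2 * A i + D i) * (2 * A′ i + D′ i))) ⟩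
      sum (λ i → D i * D′ i + (2 * A i + D i) * (2 * A′ i + D′ i))
        ≡⟨ sum-cong-≗ (λ i → expand (A i) (A′ i) (D i) (D′ i)) ⟩
      sum (λ i → 4 * (A i * A′ i) + 2 * (A i * D′ i + D i * A′ i + D i * D′ i))
        ≡⟨ sum-linear 4 2 (λ i → A i * A′ i) (λ i → A i * D′ i + D i * A′ i + D i * D′ i) ⟩
      4 * a-inner + 2 * d-inner
        ∎
      where
      left : ∀ i → ⟦ Φ x (i ↑ˡ n) *F Φ y (i ↑ˡ n) ⟧ ≋ D i * D′ i
      left i = begin
        ⟦ Φ x (i ↑ˡ n) *F Φ y (i ↑ˡ n) ⟧      ≡⟨ cong₂ (λ u v → ⟦ u *F v ⟧) (Φ-left x i) (Φ-left y i) ⟩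
        ⟦ -F d (x i) *F -F d (y i) ⟧          ≈⟨ ⟦*F⟧ ⟦ -F d (x i) ⟧-refl ⟦ -F d (y i) ⟧-refl ⟩
        ⟦ -F d (x i) ⟧ * ⟦ -F d (y i) ⟧       ≈⟨ ⟦-F⟧-product (d (x i)) (d (y i)) ⟩
        D i * D′ i                            ∎

      right : ∀ i → ⟦ Φ x (n ↑ʳ i) *F Φ y (n ↑ʳ i) ⟧ ≋ (2 * A i + D i) * (2 * A′ i + D′ i)
      right i = begin
        ⟦ Φ x (n ↑ʳ i) *F Φ y (n ↑ʳ i) ⟧
          ≡⟨ cong₂ (λ u v → ⟦ u *F v ⟧) (Φ-right x i) (Φ-right y i) ⟩
        ⟦ (2F *F a (x i) +F d (x i)) *F (2F *F a (y i) +F d (y i)) ⟧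
          ≈⟨ ⟦*F⟧ (⟦2a+d⟧ (x i)) (⟦2a+d⟧ (y i)) ⟩
        (2 * A i + D i) * (2 * A′ i + D′ i)
          ∎

      expand : ∀ A A′ D D′ → D * D′ + (2 * A + D) * (2 * A′ + D′) ≡
                             4 * (A * A′) + 2 * (A * D′ + D * A′ + D * D′)
      expand = solve-∀

proposition2 : (p : ℕ) .{{_ : NonZero p}} → Prime p → p % 3 ≡ 1 →
    (n : ℕ) (C : Vector (Field.R p) n → Set) →
    Field.IsLinearCode p C →
    Field.InFpPlusU3 p C →
    Field.SelfOrthogonalR p C →
    Field.SelfOrthogonalF p (Field.ΦImage p C)
proposition2 p _ _ n C _ C⊆Fp+u³Fp C⊆C⊥ _ _ (x , x∈C , refl) (y , y∈C , refl) =
  ⟦⟧-injective (begin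
    ⟦ Φ x ·F Φ y ⟧                              ≈⟨ ⟦gray-inner⟧ x y ⟩
    4 * a-inner x y + 2 * d-inner x y           ≈⟨ +-cong (*-cong {4} ≋-refl (sym (⟦a-inner⟧ x y)))
                                                          (*-cong {2} ≋-refl (sym (⟦d-inner⟧ x y (C⊆Fp+u³Fp x x∈C)))) ⟩
    4 * ⟦ a (x ·R y) ⟧ + 2 * ⟦ d (x ·R y) ⟧      ≡⟨ cong (λ z → 4 * ⟦ a z ⟧ + 2 * ⟦ d z ⟧) (C⊆C⊥ x y x∈C y∈C) ⟩
    4 * ⟦ 0F ⟧ + 2 * ⟦ 0F ⟧                      ≈⟨ +-cong (*-cong {4} ≋-refl ⟦0F⟧) (*-cong {2} ≋-refl ⟦0F⟧) ⟩
    0                                           ≈⟨ sym ⟦0F⟧ ⟩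
    ⟦ 0F ⟧                                      ∎)
  where
  open Field p
  open ModularArithmetic p
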